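{- Let $N$ and $M$ be well-formed labeled portnets and let $(M,\phi)$ be a partial mirror of $N$. Let $S=\textit{compose}(\{N,M\})$ with initial marking $i_S=i_N+i_M$ and final marking $f_S=f_N+f_M$. Assume the skeleton of $M$ (with initial marking $i_M$ and final marking $f_M$) is weakly terminating. Let $m$ be a marking reachable from $i_S$ in $S$ such that for some $p\in P_M$, $m(p)=m(\phi(p))=1$ and $m(q)=0$ for all places $q\notin\{p,\phi(p)\}$. Then $f_S$ is reachable from $m$.
   Context: Petri nets. Labeled Petri net $(P,T,F,\mathcal{L},\mu)$; ${}^\bullet x=\{y\mid (y,x)\in F\}$, $x^\bullet=\{y\mid (x,y)\in F\}$; markings $m:P\to\mathbb{N}$; $t$ enabled at $m$ iff ${}^\bullet t\le m$, firing gives $m-{}^\bullet t+t^\bullet$. A net system $(N,m_0,m_f)$ is weakly terminating if $m_f$ is reachable from every marking reachable from $m_0$. A path is a sequence of nodes with consecutive pairs in $F$. OPNs. $N=(P,I,O,T,F,\textit{init},\textit{fin},\mathcal{L},\mu)$, $P,I,O$ pairwise disjoint, $(P\cup I\cup O,T,F,\mathcal{L},\mu)$ labeled Petri net, ${}^\bullet x=\emptyset$ for $x\in I$, $x^\bullet=\emptyset$ for $x\in O$, each $t$ has ${}^\bullet t\cap I=\emptyset$ or $t^\bullet\cap O=\emptyset$, $\textit{init},\textit{fin}\subseteq P$. $\lambda(t)=\textit{send}$ if $t^\bullet\cap O\ne\emptyset$, $\textit{receive}$ if ${}^\bullet t\cap I\ne\emptyset$, else $\tau$. Skeleton: net on $P,T$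 with arcs $F\cap((P\times T)\cup(T\times P))$. Labeled portnet: OPN whose skeleton has each transition with at most one input and one output place and is a workflow net (unique place $i$ with empty preset, unique $f$ with empty postset, all nodes on a path from $i$ to $f$), $\textit{init}=\{i\}$, $\textit{fin}=\{f\}$ (written $i_N,f_N$); each transition connected to exactly one interface place; transitions sharing an interface place share a label; equally labeled transitions are connected to the same interface place(s). Composition: $N,M$ composable iff shared nodes are exactly $(I_N\cup O_N)\cap(I_M\cup O_M)$ and, if $(I_N\cap O_M)\cup(I_M\cap O_N)\ne\emptyset$, then $O_N\subseteq I_M$, $O_M\subseteq I_N$, $I_N\cap I_M=O_N\cap O_M=\emptyset$. $\textit{compose}$: places $\bigcup P\cup(\bigcup I\cap\bigcup O)$, inputs $\bigcup I\setminus\bigcup O$, outputs $\bigcup O\setminus\bigcup I$, other components unions. Partial mirror of $N$: $(M,\phi)$, $M$ a labeled portnet, $\phi$ injective from nodes of $M$ to nodes of $N$ with $\phi(P_M)\subseteq P_N$, $\phi(T_M)\subseteq T_N$, $\phi(I_M)\subseteq O_N$, $\phi(O_M)\subseteq I_N$; for $(x,y)\in F_M$: if $x\notin I_M,y\notin O_M$ then $(\phi(x),\phi(y))\in F_N$, if $x\in I_M$ or $y\in O_M$ then $(\phi(y),\phi(x))\in F_N$; $\phi(\textit{init}_M)=\textit{init}_N$, $\phi(\textit{fin}_M)=\textit{fin}_N$; $\mu_M(t)=\mu_N(\phi(t))$; for all $p\in P_M$, $t\in\phi(p)^\bullet$ with $\lambda(t)=\textit{send}$ there is $t'\in p^\bullet$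 with $\phi(t')=t$. In $\textit{compose}(\{N,M\})$ each interface place $x$ of $M$ is the same place as $\phi(x)$, and $N,M$ share no other nodes. Well-formed labeled portnet: observable choices (distinct $t,t'\in p^\bullet$ have distinct labels); diamond property (for $p\in P$, $t,t'\in p^\bullet$ with $\lambda(t)\ne\lambda(t')$, for all $q\in t^\bullet\cap P$, $q'\in t'^\bullet\cap P$ there are $u\in q^\bullet$, $u'\in q'^\bullet$ with $u^\bullet\cap u'^\bullet\ne\emptyset$, $\mu(t)=\mu(u')$, $\mu(t')=\mu(u)$); loop property (for $p\in P$ and distinct $t,t'\in p^\bullet$ with $\lambda(t)=\lambda(t')$, every path $\langle p\rangle\circ\pi$ whose transitions are $\langle t\rangle\circ\sigma\circ\langle t''\rangle$ with $\mu(t'')=\mu(t')$ and no transition of $\sigma$ labeled $\mu(t')$ contains a transition of direction $\ne\lambda(t)$). -}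

module Defs where

open import Data.Nat using (ℕ; _≤_; _∸_; _+_; _≟_)
open import Data.Bool using (if_then_else_)
open import Data.List using (List; []; _∷_; _++_; filter)
open import Data.List.Membership.Propositional using (_∈_; _∉_)
open import Data.List.Relation.Unary.Any using (Any; any?)
open import Data.List.Relation.Unary.All using (All)
open import Data.List.Relation.Unary.Linked using (Linked)
open import Data.Product using (Σ; ∃; _×_; _,_; proj₁; proj₂)
open import Data.Product.Properties using (≡-dec)
open import Data.Sum using (_⊎_)
open import Relation.Nullary using (¬_; does)
open import Relation.Nullary.Decidable using (_×-dec_; _⊎-dec_)
open import Relation.Binary.PropositionalEquality using (_≡_; _≢_)
open import Relation.Binary.Construct.Closure.ReflexiveTransitive using (Star)
open import Function.Bundles using (_⇔_)
import Data.List.Membership.DecPropositional as DecMem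

-- Nodes (places, transitions, interface places) are natural numbers;
-- finite sets of nodes are lists (duplicates are irrelevant), the flow
-- relation is a finite list of pairs.

open DecMem _≟_ using () renaming (_∈?_ to _∈ℕ?_)
open DecMem (≡-dec _≟_ _≟_) using () renaming (_∈?_ to _∈ₚ?_)

Marking : Set
Marking = ℕ → ℕ

record Net : Set where
  field
    trans : List ℕ
    arcs  : List (ℕ × ℕ)

pre : Net → ℕ → Marking
pre n t x = if does ((x , t) ∈ₚ? Net.arcs n) then 1 else 0

post : Net → ℕ → Marking
post n t x = if does ((t , x) ∈ₚ? Net.arcs n) then 1 else 0

Enabled : Net → Marking → ℕ → Set
Enabled n m t = ∀ x → pre n t x ≤ m x

Step : Net → Marking → Marking → Set
Step n m m' = Σ ℕ λ t → t ∈ Net.trans n × Enabled n m t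
                × (∀ x → m' x ≡ (m x ∸ pre n t x) + post n t x)

Reach : Net → Marking → Marking → Set
Reach n m m' = Σ Marking λ m'' → Star (Step n) m m'' × (∀ x → m'' x ≡ m' x)

WeaklyTerminating : Net → Marking → Marking → Set
WeaklyTerminating n m0 mf = ∀ m → Reach n m0 m → Reach n m mf

setMarking : List ℕ → Marking
setMarking A x = if does (x ∈ℕ? A) then 1 else 0

_⊕_ : Marking → Marking → Marking
(m ⊕ m') x = m x + m' x

record OPN (L : Set) : Set where
  field
    P I O T   : List ℕ
    F         : List (ℕ × ℕ)
    init fin  : List ℕ
    μ         : ℕ → L

module _ {L : Set} (N : OPN L) where
  open OPN N

  Places : List ℕ
  Places = P ++ I ++ O

  Nodes : List ℕ
  Nodes = Places ++ T

  Interface : List ℕ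
  Interface = I ++ O

  Arc : ℕ → ℕ → Set
  Arc x y = (x , y) ∈ F

  Conn : ℕ → ℕ → Set
  Conn x t = Arc x t ⊎ Arc t x

  netOf : Net
  netOf = record { trans = T ; arcs = F }

  skeleton : Net
  skeleton = record
    { trans = T
    ; arcs  = filter (λ a → ((proj₁ a ∈ℕ? P) ×-dec (proj₂ a ∈ℕ? T))
                           ⊎-dec ((proj₁ a ∈ℕ? T) ×-dec (proj₂ a ∈ℕ? P))) F }

  SkelArc : ℕ → ℕ → Set
  SkelArc x y = Arc x y × ((x ∈ P × y ∈ T) ⊎ (x ∈ T × y ∈ P))

  record IsOPN : Set where
    field
      PI-disj : ∀ x → x ∈ P → x ∉ I
      PO-disj : ∀ x → x ∈ P → x ∉ O
      IO-disj : ∀ x → x ∈ I → x ∉ O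
      PT-disj : ∀ x → x ∈ Places → x ∉ T
      arcs-ok : ∀ x y → Arc x y → (x ∈ Places × y ∈ T) ⊎ (x ∈ T × y ∈ Places)
      I-nopre  : ∀ x y → x ∈ I → ¬ Arc y x
      O-nopost : ∀ x y → x ∈ O → ¬ Arc x y
      send-or-receive : ∀ t → t ∈ T →
        (∀ x → x ∈ I → ¬ Arc x t) ⊎ (∀ x → x ∈ O → ¬ Arc t x)
      init⊆P : ∀ x → x ∈ init → x ∈ P
      fin⊆P  : ∀ x → x ∈ fin → x ∈ P

data Dir : Set where
  send receive tau : Dir

dir : {L : Set} → OPN L → ℕ → Dir
dir N t =
  if does (any? (λ o → (t , o) ∈ₚ? OPN.F N) (OPN.O N)) then send
  else if does (any? (λ i → (i , t) ∈ₚ? OPN.F N) (OPN.I N)) then receive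
  else tau

module _ {L : Set} (N : OPN L) where
  open OPN N

  transOf : List ℕ → List ℕ
  transOf xs = filter (_∈ℕ? T) xs

  record IsWorkflowSkeleton (i f : ℕ) : Set where
    field
      i∈P     : i ∈ P
      i-src   : ∀ y → ¬ SkelArc N y i
      i-uniq  : ∀ p → p ∈ P → (∀ y → ¬ SkelArc N y p) → p ≡ i
      f∈P     : f ∈ P
      f-sink  : ∀ y → ¬ SkelArc N f y
      f-uniq  : ∀ p → p ∈ P → (∀ y → ¬ SkelArc N p y) → p ≡ f
      on-path : ∀ x → x ∈ P ++ T → Star (SkelArc N) i x × Star (SkelArc N) x f

  record IsLabeledPortnet : Set where
    field
      isOPN    : IsOPN N
      one-in   : ∀ t p q → t ∈ T → p ∈ P → q ∈ P → Arc N p t → Arc N q t → p ≡ q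
      one-out  : ∀ t p q → t ∈ T → p ∈ P → q ∈ P → Arc N t p → Arc N t q → p ≡ q
      iN fN    : ℕ
      workflow : IsWorkflowSkeleton iN fN
      init≡    : ∀ x → (x ∈ init) ⇔ (x ≡ iN)
      fin≡     : ∀ x → (x ∈ fin) ⇔ (x ≡ fN)
      one-interface : ∀ t → t ∈ T → Σ ℕ λ x → x ∈ Interface N × Conn N x t
                        × (∀ y → y ∈ Interface N → Conn N y t → y ≡ x)
      shared-label : ∀ t t' x → t ∈ T → t' ∈ T → x ∈ Interface N
                       → Conn N x t → Conn N x t' → μ t ≡ μ t'
      label-interface : ∀ t t' x → t ∈ T → t' ∈ T → μ t ≡ μ t'
                       → x ∈ Interface N → Conn N x t → Conn N x t'

  ObservableChoices : Set
  ObservableChoices = ∀ p t t' → p ∈ P → Arc N p t → Arc N p t' → t ≢ t' → μ t ≢ μ t'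

  DiamondProperty : Set
  DiamondProperty = ∀ p t t' → p ∈ P → Arc N p t → Arc N p t' → dir N t ≢ dir N t'
    → ∀ q q' → Arc N t q → q ∈ P → Arc N t' q' → q' ∈ P
    → Σ ℕ λ u → Σ ℕ λ u' → Arc N q u × Arc N q' u'
        × (Σ ℕ λ r → Arc N u r × Arc N u' r)
        × μ t ≡ μ u' × μ t' ≡ μ u

  LoopProperty : Set
  LoopProperty = ∀ p t t' → p ∈ P → Arc N p t → Arc N p t' → t ≢ t'
    → dir N t ≡ dir N t'
    → ∀ (π : List ℕ) → Linked (Arc N) (p ∷ π)
    → ∀ (σ : List ℕ) (t'' : ℕ) → transOf (p ∷ π) ≡ t ∷ σ ++ t'' ∷ []
    → μ t'' ≡ μ t' → All (λ s → μ s ≢ μ t') σ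
    → Any (λ s → dir N s ≢ dir N t) (t ∷ σ ++ t'' ∷ [])

  record WellFormed : Set where
    field
      portnet    : IsLabeledPortnet
      observable : ObservableChoices
      diamond    : DiamondProperty
      loop       : LoopProperty

module _ {L : Set} (N M : OPN L) where
  module N = OPN N
  module M = OPN M

  record PartialMirror (φ : ℕ → ℕ) : Set where
    field
      M-portnet : IsLabeledPortnet M
      injective : ∀ x y → x ∈ Nodes M → y ∈ Nodes M → φ x ≡ φ y → x ≡ y
      P↦P : ∀ x → x ∈ M.P → φ x ∈ N.P
      T↦T : ∀ x → x ∈ M.T → φ x ∈ N.T
      I↦O : ∀ x → x ∈ M.I → φ x ∈ N.O
      O↦I : ∀ x → x ∈ M.O → φ x ∈ N.I
      arc-inner : ∀ x y → Arc M x y → x ∉ M.I → y ∉ M.O → Arc N (φ x) (φ y)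
      arc-iface : ∀ x y → Arc M x y → (x ∈ M.I ⊎ y ∈ M.O) → Arc N (φ y) (φ x)
      init↦ : ∀ x → (x ∈ N.init) ⇔ (Σ ℕ λ y → y ∈ M.init × φ y ≡ x)
      fin↦  : ∀ x → (x ∈ N.fin) ⇔ (Σ ℕ λ y → y ∈ M.fin × φ y ≡ x)
      labels : ∀ t → t ∈ M.T → M.μ t ≡ N.μ (φ t)
      sends  : ∀ p t → p ∈ M.P → Arc N (φ p) t → dir N t ≡ send
                 → Σ ℕ λ t' → Arc M p t' × φ t' ≡ t

  -- in compose({N,M}) each interface place x of M is φ(x), and N and M
  -- share no other nodes
  record MirrorIdentified (φ : ℕ → ℕ) : Set where
    field
      iface-fixed : ∀ x → x ∈ Interface M → φ x ≡ x
      shared-only-iface : ∀ x → x ∈ Nodes N → x ∈ Nodes M → x ∈ Interface M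

  record Composable : Set where
    field
      shared : ∀ x → (x ∈ Nodes N × x ∈ Nodes M) ⇔ (x ∈ Interface N × x ∈ Interface M)
      connected : (Σ ℕ λ x → (x ∈ N.I × x ∈ M.O) ⊎ (x ∈ M.I × x ∈ N.O)) →
        (∀ x → x ∈ N.O → x ∈ M.I) × (∀ x → x ∈ M.O → x ∈ N.I)
        × (∀ x → x ∈ N.I → x ∉ M.I) × (∀ x → x ∈ N.O → x ∉ M.O)

  compose : OPN L
  compose = record
    { P = N.P ++ M.P ++ filter (λ x → (x ∈ℕ? (N.I ++ M.I)) ×-dec (x ∈ℕ? (N.O ++ M.O)))
                                  (N.I ++ M.I)
    ; I = filter (λ x → ¬? (x ∈ℕ? (N.O ++ M.O))) (N.I ++ M.I)
    ; O = filter (λ x → ¬? (x ∈ℕ? (N.I ++ M.I))) (N.O ++ M.O)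
    ; T = N.T ++ M.T
    ; F = N.F ++ M.F
    ; init = N.init ++ M.init
    ; fin  = N.fin ++ M.fin
    ; μ = λ t → if does (t ∈ℕ? N.T) then N.μ t else M.μ t
    }
    where open import Relation.Nullary.Decidable using (¬?)

{-# OPTIONS --safe #-}
-- A token on p together with one on its mirror image φ p can always be moved one skeleton
-- step forward: a transition t of M with arcs p → t → q is attached to exactly one interface
-- place x, and φ t has arcs φ p → φ t → φ q and is attached to the same x in the opposite
-- direction. Firing the sender of the pair {t, φ t} and then the receiver moves the tokens to
-- q and φ q. As M is a workflow net there is a skeleton path from p to f_M, and walking it
-- reaches f_M + φ f_M = f_M + f_N. The hypothesis pins m down only on the places of S; it
-- vanishes elsewhere because firing only produces tokens on places.

module Submission where

open import Defs
open import Data.Nat using (ℕ; _+_; _∸_; _≤_; _≟_)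
open import Data.Nat.Properties using (+-comm; +-commutativeSemigroup; m≤n+m; m+n∸n≡m; 0∸n≡0)
open import Data.Bool using (if_then_else_)
open import Data.List using (List; _++_)
open import Data.List.Membership.Propositional using (_∈_; _∉_)
open import Data.List.Membership.Propositional.Properties
  using (∈-++⁺ˡ; ∈-++⁺ʳ; ∈-++⁻; ∈-filter⁺)
open import Data.Product using (_×_; _,_; proj₁; proj₂)
open import Data.Product.Properties using (≡-dec)
open import Data.Sum using (_⊎_; inj₁; inj₂; [_,_]′)
open import Function using (id; _∘_)
open import Function.Bundles using (_⇔_; mk⇔; Equivalence)
open import Function.Construct.Composition using (_⇔-∘_)
open import Function.Construct.Symmetry using (⇔-sym)
open import Relation.Nullary using (¬_; Dec; yes; no; does; contradiction)
open import Relation.Nullary.Decidable using (dec-true; dec-false; does-⇔; _⊎-dec_)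
open import Relation.Binary.PropositionalEquality
  using (_≡_; _≢_; _≗_; refl; sym; trans; cong; cong₂; subst; subst₂; module ≡-Reasoning)
open import Relation.Binary.Construct.Closure.ReflexiveTransitive using (Star; ε; _◅_; _◅◅_)
open import Algebra.Properties.CommutativeSemigroup +-commutativeSemigroup using (x∙yz≈y∙xz)
import Data.List.Membership.DecPropositional as DecMembership

open DecMembership _≟_ using () renaming (_∈?_ to _∈ℕ?_)
open DecMembership (≡-dec _≟_ _≟_) using () renaming (_∈?_ to _∈ₚ?_)

variable
  A B C : Set
  n n′ : Net
  m₁ m₂ m₃ : Marking
  a a′ b b′ p q s r t x y z : ℕ

indicator : Dec A → ℕ
indicator d = if does d then 1 else 0

indicator-yes : (a? : Dec A) → A → indicator a? ≡ 1
indicator-yes a? α = cong (λ β → if β then 1 else 0) (dec-true a? α)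

indicator-no : (a? : Dec A) → ¬ A → indicator a? ≡ 0
indicator-no a? ¬α = cong (λ β → if β then 1 else 0) (dec-false a? ¬α)

indicator-⇔ : A ⇔ B → (a? : Dec A) (b? : Dec B) → indicator a? ≡ indicator b?
indicator-⇔ A⇔B a? b? = cong (λ β → if β then 1 else 0) (does-⇔ A⇔B a? b?)

indicator-⊎ : ¬ (B × C) → A ⇔ (B ⊎ C) → (a? : Dec A) (b? : Dec B) (c? : Dec C)
  → indicator a? ≡ indicator b? + indicator c?
indicator-⊎ disjoint A⇔B⊎C a? b? c? = trans (indicator-⇔ A⇔B⊎C a? (b? ⊎-dec c?)) (split b? c?)
  where
  split : (b? : Dec _) (c? : Dec _) → indicator (b? ⊎-dec c?) ≡ indicator b? + indicator c?
  split (yes β) (yes γ) = contradiction (β , γ) disjoint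
  split (yes _) (no _)  = refl
  split (no _)  (yes _) = refl
  split (no _)  (no _)  = refl

token : ℕ → Marking
token a x = indicator (x ≟ a)

token-self : ∀ a → token a a ≡ 1
token-self a = indicator-yes (a ≟ a) refl

token-other : x ≢ a → token a x ≡ 0
token-other {x} {a} = indicator-no (x ≟ a)

⊕-comm : ∀ m₁ m₂ → (m₁ ⊕ m₂) ≗ (m₂ ⊕ m₁)
⊕-comm m₁ m₂ x = +-comm (m₁ x) (m₂ x)

⊕-swap : ∀ m₁ m₂ m₃ → (m₁ ⊕ (m₂ ⊕ m₃)) ≗ (m₂ ⊕ (m₁ ⊕ m₃))
⊕-swap m₁ m₂ m₃ x = x∙yz≈y∙xz (m₁ x) (m₂ x) (m₃ x)

fire : ∀ R {Pre Post} → t ∈ Net.trans n → pre n t ≗ Pre → post n t ≗ Post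
  → Step n (R ⊕ Pre) (R ⊕ Post)
fire {t = t} {n = n} R {Pre} {Post} t∈T pre≗ post≗ = t , t∈T , enabled , fired
  where
  enabled : Enabled n (R ⊕ Pre) t
  enabled x = subst₂ _≤_ (sym (pre≗ x)) refl (m≤n+m (Pre x) (R x))
  fired : ∀ x → R x + Post x ≡ (R x + Pre x ∸ pre n t x) + post n t x
  fired x rewrite pre≗ x | post≗ x | m+n∸n≡m (R x) (Pre x) = refl

Step-respˡ : m₁ ≗ m₂ → Step n m₂ m₃ → Step n m₁ m₃
Step-respˡ {n = n} m₁≗m₂ (t , t∈T , enabled , fired) =
  t , t∈T , (λ x → subst (pre n t x ≤_) (sym (m₁≗m₂ x)) (enabled x))
    , (λ x → trans (fired x) (cong (λ k → k ∸ pre n t x + post n t x) (sym (m₁≗m₂ x))))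

Reach-≗ : m₁ ≗ m₂ → Reach n m₁ m₂
Reach-≗ m₁≗m₂ = _ , ε , m₁≗m₂

Reach-respˡ : m₁ ≗ m₂ → Reach n m₂ m₃ → Reach n m₁ m₃
Reach-respˡ m₁≗m₂ (_ , ε , m₂≗m₃)     = _ , ε , λ x → trans (m₁≗m₂ x) (m₂≗m₃ x)
Reach-respˡ {n = n} m₁≗m₂ (_ , s ◅ run , end) = _ , Step-respˡ {n = n} m₁≗m₂ s ◅ run , end

Reach-respʳ : m₂ ≗ m₃ → Reach n m₁ m₂ → Reach n m₁ m₃
Reach-respʳ m₂≗m₃ (_ , run , end) = _ , run , λ x → trans (end x) (m₂≗m₃ x)

Reach-trans : Reach n m₁ m₂ → Reach n m₂ m₃ → Reach n m₁ m₃
Reach-trans {n = n} (_ , run₁ , end₁) r with Reach-respˡ {n = n} end₁ r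
... | _ , run₂ , end₂ = _ , run₁ ◅◅ run₂ , end₂

pre-≗-token : (∀ y → (y , t) ∈ Net.arcs n ⇔ y ≡ a) → pre n t ≗ token a
pre-≗-token {t} {n} {a} arcs⇔ x = indicator-⇔ (arcs⇔ x) ((x , t) ∈ₚ? Net.arcs n) (x ≟ a)

post-≗-token : (∀ y → (t , y) ∈ Net.arcs n ⇔ y ≡ a) → post n t ≗ token a
post-≗-token {t} {n} {a} arcs⇔ x = indicator-⇔ (arcs⇔ x) ((t , x) ∈ₚ? Net.arcs n) (x ≟ a)

distinct : a ≢ b → ¬ (x ≡ a × x ≡ b)
distinct a≢b (refl , refl) = a≢b refl

pre-≗-token₂ : a ≢ b → (∀ y → (y , t) ∈ Net.arcs n ⇔ (y ≡ a ⊎ y ≡ b))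
  → pre n t ≗ token a ⊕ token b
pre-≗-token₂ {a} {b} {t} {n} a≢b arcs⇔ x =
  indicator-⊎ (distinct a≢b) (arcs⇔ x) ((x , t) ∈ₚ? Net.arcs n) (x ≟ a) (x ≟ b)

post-≗-token₂ : a ≢ b → (∀ y → (t , y) ∈ Net.arcs n ⇔ (y ≡ a ⊎ y ≡ b))
  → post n t ≗ token a ⊕ token b
post-≗-token₂ {a} {b} {t} {n} a≢b arcs⇔ x =
  indicator-⊎ (distinct a≢b) (arcs⇔ x) ((t , x) ∈ₚ? Net.arcs n) (x ≟ a) (x ≟ b)

record Sends (n : Net) (t a a′ x : ℕ) : Set where
  field
    a′≢x    : a′ ≢ x
    inputs  : ∀ y → (y , t) ∈ Net.arcs n ⇔ y ≡ a
    outputs : ∀ y → (t , y) ∈ Net.arcs n ⇔ (y ≡ a′ ⊎ y ≡ x)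

record Receives (n : Net) (t b b′ x : ℕ) : Set where
  field
    b≢x     : b ≢ x
    inputs  : ∀ y → (y , t) ∈ Net.arcs n ⇔ (y ≡ b ⊎ y ≡ x)
    outputs : ∀ y → (t , y) ∈ Net.arcs n ⇔ y ≡ b′

handshake : s ∈ Net.trans n → r ∈ Net.trans n → Sends n s a a′ x → Receives n r b b′ x
  → Reach n (token a ⊕ token b) (token a′ ⊕ token b′)
handshake {n = n} {a = a} {a′ = a′} {x = x} {b = b} {b′ = b′} s∈T r∈T sends receives =
  _ , sender-fires ◅ Step-respˡ {n = n} (⊕-swap (token b) (token a′) (token x)) receiver-fires ◅ ε
  , λ _ → refl
  where
  module S = Sends sends
  module R = Receives receives
  sender-fires : Step n (token a ⊕ token b) (token b ⊕ (token a′ ⊕ token x))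
  sender-fires = Step-respˡ {n = n} (⊕-comm (token a) (token b))
    (fire {n = n} (token b) s∈T (pre-≗-token {n = n} S.inputs)
                                (post-≗-token₂ {n = n} S.a′≢x S.outputs))
  receiver-fires : Step n (token a′ ⊕ (token b ⊕ token x)) (token a′ ⊕ token b′)
  receiver-fires =
    fire {n = n} (token a′) r∈T (pre-≗-token₂ {n = n} R.b≢x R.inputs)
                                 (post-≗-token {n = n} R.outputs)

ArcsAgreeAt : Net → Net → ℕ → Set
ArcsAgreeAt n n′ t = ∀ y → ((y , t) ∈ Net.arcs n ⇔ (y , t) ∈ Net.arcs n′)
                         × ((t , y) ∈ Net.arcs n ⇔ (t , y) ∈ Net.arcs n′)

Sends-transport : ArcsAgreeAt n n′ t → Sends n t a a′ x → Sends n′ t a a′ x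
Sends-transport agree sends = record
  { a′≢x    = a′≢x
  ; inputs  = λ y → inputs y ⇔-∘ ⇔-sym (proj₁ (agree y))
  ; outputs = λ y → outputs y ⇔-∘ ⇔-sym (proj₂ (agree y))
  }
  where open Sends sends

Receives-transport : ArcsAgreeAt n n′ t → Receives n t b b′ x → Receives n′ t b b′ x
Receives-transport agree receives = record
  { b≢x     = b≢x
  ; inputs  = λ y → inputs y ⇔-∘ ⇔-sym (proj₁ (agree y))
  ; outputs = λ y → outputs y ⇔-∘ ⇔-sym (proj₂ (agree y))
  }
  where open Receives receives

SupportedOn : Marking → List ℕ → Set
SupportedOn m A = ∀ x → x ∉ A → m x ≡ 0

module _ {n : Net} {Pl : List ℕ}
         (outputs∈Pl : ∀ {t y} → t ∈ Net.trans n → (t , y) ∈ Net.arcs n → y ∈ Pl) where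

  Step-supportedOn : Step n m₁ m₂ → SupportedOn m₁ Pl → SupportedOn m₂ Pl
  Step-supportedOn {m₁} (t , t∈T , _ , fired) m₁-supported x x∉Pl = begin
    _                               ≡⟨ fired x ⟩
    (m₁ x ∸ pre n t x) + post n t x ≡⟨ cong (λ k → k ∸ pre n t x + post n t x)
                                            (m₁-supported x x∉Pl) ⟩
    (0 ∸ pre n t x) + post n t x    ≡⟨ cong (_+ post n t x) (0∸n≡0 (pre n t x)) ⟩
    post n t x                      ≡⟨ indicator-no ((t , x) ∈ₚ? Net.arcs n)
                                                    (x∉Pl ∘ outputs∈Pl t∈T) ⟩
    0                               ∎
    where open ≡-Reasoning

  Star-supportedOn : Star (Step n) m₁ m₂ → SupportedOn m₁ Pl → SupportedOn m₂ Pl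
  Star-supportedOn ε             supported = supported
  Star-supportedOn (step ◅ run) supported = Star-supportedOn run (Step-supportedOn step supported)

≗-token₂ : ∀ {Pl} → a ≢ b → m₁ a ≡ 1 → m₁ b ≡ 1 → SupportedOn m₁ Pl
  → (∀ x → x ∈ Pl → x ≢ a → x ≢ b → m₁ x ≡ 0) → m₁ ≗ token a ⊕ token b
≗-token₂ {a} {b} {m₁} {Pl} a≢b ma≡1 mb≡1 supported elsewhere x with x ≟ a | x ≟ b
... | yes refl | yes refl = contradiction refl a≢b
... | yes refl | no x≢b   = trans ma≡1 (sym (cong₂ _+_ (token-self a) (token-other x≢b)))
... | no x≢a   | yes refl = trans mb≡1 (sym (cong₂ _+_ (token-other x≢a) (token-self b)))
... | no x≢a   | no x≢b   = trans m₁x≡0 (sym (cong₂ _+_ (token-other x≢a) (token-other x≢b)))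
  where
  m₁x≡0 : m₁ x ≡ 0
  m₁x≡0 with x ∈ℕ? Pl
  ... | yes x∈Pl = elsewhere x x∈Pl x≢a x≢b
  ... | no x∉Pl  = supported x x∉Pl

module OPN-Properties {L : Set} {K : OPN L} (isOPN : IsOPN K) where
  open OPN K
  open IsOPN isOPN

  P⊆Places : x ∈ P → x ∈ Places K
  P⊆Places = ∈-++⁺ˡ

  Interface⊆Places : x ∈ Interface K → x ∈ Places K
  Interface⊆Places = ∈-++⁺ʳ P

  place∉T : x ∈ Places K → x ∉ T
  place∉T = PT-disj _

  T∉Interface : t ∈ T → t ∉ Interface K
  T∉Interface t∈T t∈Interface = place∉T (Interface⊆Places t∈Interface) t∈T

  init⊆Places : x ∈ init → x ∈ Places K
  init⊆Places = P⊆Places ∘ init⊆P _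

  P∉Interface : x ∈ P → x ∉ Interface K
  P∉Interface x∈P x∈Interface with ∈-++⁻ I x∈Interface
  ... | inj₁ x∈I = PI-disj _ x∈P x∈I
  ... | inj₂ x∈O = PO-disj _ x∈P x∈O

  arc-endpoints : Arc K y z → y ∈ Nodes K × z ∈ Nodes K
  arc-endpoints {y} {z} yz with arcs-ok y z yz
  ... | inj₁ (y∈Places , z∈T) = ∈-++⁺ˡ y∈Places , ∈-++⁺ʳ (Places K) z∈T
  ... | inj₂ (y∈T , z∈Places) = ∈-++⁺ʳ (Places K) y∈T , ∈-++⁺ˡ z∈Places

  output-place : t ∈ T → Arc K t y → y ∈ Places K
  output-place {t} {y} t∈T ty with arcs-ok t y ty
  ... | inj₁ (t∈Places , _) = contradiction t∈T (place∉T t∈Places)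
  ... | inj₂ (_ , y∈Places) = y∈Places

module LabeledPortnet {L : Set} {K : OPN L} (portnet : IsLabeledPortnet K) where
  open OPN K
  open IsLabeledPortnet portnet public
  open IsOPN isOPN public
  open OPN-Properties isOPN public

  interface-unique : t ∈ T → x ∈ Interface K → Conn K x t → y ∈ Interface K → Conn K y t → y ≡ x
  interface-unique {t} t∈T x∈Interface xt y∈Interface yt with one-interface t t∈T
  ... | _ , _ , _ , unique = trans (unique _ y∈Interface yt) (sym (unique _ x∈Interface xt))

  input≡place⊎interface : t ∈ T → p ∈ P → Arc K p t → x ∈ Interface K → Conn K x t
    → Arc K y t → y ≡ p ⊎ y ≡ x
  input≡place⊎interface {t} {p} {y = y} t∈T p∈P pt x∈Interface xt yt with arcs-ok y t yt
  ... | inj₂ (_ , t∈Places) = contradiction t∈T (place∉T t∈Places)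
  ... | inj₁ (y∈Places , _) with ∈-++⁻ P y∈Places
  ...   | inj₁ y∈P         = inj₁ (one-in t y p t∈T y∈P p∈P yt pt)
  ...   | inj₂ y∈Interface = inj₂ (interface-unique t∈T x∈Interface xt y∈Interface (inj₁ yt))

  output≡place⊎interface : t ∈ T → q ∈ P → Arc K t q → x ∈ Interface K → Conn K x t
    → Arc K t y → y ≡ q ⊎ y ≡ x
  output≡place⊎interface {t} {q} {y = y} t∈T q∈P tq x∈Interface xt ty with arcs-ok t y ty
  ... | inj₁ (t∈Places , _) = contradiction t∈T (place∉T t∈Places)
  ... | inj₂ (_ , y∈Places) with ∈-++⁻ P y∈Places
  ...   | inj₁ y∈P         = inj₁ (one-out t y q t∈T y∈P q∈P ty tq)
  ...   | inj₂ y∈Interface = inj₂ (interface-unique t∈T x∈Interface xt y∈Interface (inj₂ ty))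

  receiving : t ∈ T → p ∈ P → q ∈ P → x ∈ I → Arc K p t → Arc K t q → Arc K x t
    → Receives (netOf K) t p q x
  receiving {t} {p} {q} {x} t∈T p∈P q∈P x∈I pt tq xt = record
    { b≢x     = λ { refl → PI-disj p p∈P x∈I }
    ; inputs  = λ _ → mk⇔ (input≡place⊎interface t∈T p∈P pt x∈Interface (inj₁ xt))
                          [ (λ { refl → pt }) , (λ { refl → xt }) ]′
    ; outputs = λ _ → mk⇔ (λ ty → [ id , (λ { refl → contradiction ty (I-nopre x t x∈I) }) ]′
                                 (output≡place⊎interface t∈T q∈P tq x∈Interface (inj₁ xt) ty))
                          (λ { refl → tq })
    }
    where
    x∈Interface : x ∈ Interface K
    x∈Interface = ∈-++⁺ˡ x∈I

  sending : t ∈ T → p ∈ P → q ∈ P → x ∈ O → Arc K p t → Arc K t q → Arc K t x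
    → Sends (netOf K) t p q x
  sending {t} {p} {q} {x} t∈T p∈P q∈P x∈O pt tq tx = record
    { a′≢x    = λ { refl → PO-disj q q∈P x∈O }
    ; inputs  = λ _ → mk⇔ (λ yt → [ id , (λ { refl → contradiction yt (O-nopost x t x∈O) }) ]′
                                 (input≡place⊎interface t∈T p∈P pt x∈Interface (inj₂ tx) yt))
                          (λ { refl → pt })
    ; outputs = λ _ → mk⇔ (output≡place⊎interface t∈T q∈P tq x∈Interface (inj₂ tx))
                          [ (λ { refl → tq }) , (λ { refl → tx }) ]′
    }
    where
    x∈Interface : x ∈ Interface K
    x∈Interface = ∈-++⁺ʳ I x∈O

  setMarking-fin : setMarking fin ≗ token fN
  setMarking-fin x = indicator-⇔ (fin≡ x) (x ∈ℕ? fin) (x ≟ fN)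

module Mirrored {L : Set} {N M : OPN L} {φ : ℕ → ℕ}
  (N-portnet : IsLabeledPortnet N) (mirror : PartialMirror N M φ)
  (composable : Composable N M) (identified : MirrorIdentified N M φ) where

  private
    module 𝒩 = OPN N
    module ℳ = OPN M
    module PN = LabeledPortnet N-portnet
    module PM = LabeledPortnet (PartialMirror.M-portnet mirror)
  open PartialMirror mirror
  open MirrorIdentified identified

  S : OPN L
  S = compose N M

  Sn : Net
  Sn = netOf S

  shared-node-interface : x ∈ Nodes N → x ∈ Nodes M → x ∈ Interface N × x ∈ Interface M
  shared-node-interface {x} x∈N x∈M = Equivalence.to (Composable.shared composable x) (x∈N , x∈M)

  M-transition∉Nodes-N : t ∈ ℳ.T → t ∉ Nodes N
  M-transition∉Nodes-N t∈T t∈N =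
    PM.T∉Interface t∈T (proj₂ (shared-node-interface t∈N (∈-++⁺ʳ (Places M) t∈T)))

  N-transition∉Nodes-M : t ∈ 𝒩.T → t ∉ Nodes M
  N-transition∉Nodes-M t∈T t∈M =
    PN.T∉Interface t∈T (proj₁ (shared-node-interface (∈-++⁺ʳ (Places N) t∈T) t∈M))

  arcs-agree-N : t ∈ 𝒩.T → ArcsAgreeAt (netOf N) Sn t
  arcs-agree-N {t} t∈T _ = mk⇔ ∈-++⁺ˡ (arc-of-N (proj₂ ∘ PM.arc-endpoints))
                         , mk⇔ ∈-++⁺ˡ (arc-of-N (proj₁ ∘ PM.arc-endpoints))
    where
    arc-of-N : ∀ {u v} → (Arc M u v → t ∈ Nodes M) → Arc S u v → Arc N u v
    arc-of-N t∈M uv = [ id , (λ uv∈M → contradiction (t∈M uv∈M) (N-transition∉Nodes-M t∈T)) ]′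
                        (∈-++⁻ 𝒩.F uv)

  arcs-agree-M : t ∈ ℳ.T → ArcsAgreeAt (netOf M) Sn t
  arcs-agree-M {t} t∈T _ = mk⇔ (∈-++⁺ʳ 𝒩.F) (arc-of-M (proj₂ ∘ PN.arc-endpoints))
                         , mk⇔ (∈-++⁺ʳ 𝒩.F) (arc-of-M (proj₁ ∘ PN.arc-endpoints))
    where
    arc-of-M : ∀ {u v} → (Arc N u v → t ∈ Nodes N) → Arc S u v → Arc M u v
    arc-of-M t∈N uv = [ (λ uv∈N → contradiction (t∈N uv∈N) (M-transition∉Nodes-N t∈T)) , id ]′
                        (∈-++⁻ 𝒩.F uv)

  input∈Places-S : x ∈ 𝒩.I ++ ℳ.I → x ∈ Places S
  input∈Places-S {x} x∈I with x ∈ℕ? (𝒩.O ++ ℳ.O)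
  ... | yes x∈O = ∈-++⁺ˡ (∈-++⁺ʳ 𝒩.P (∈-++⁺ʳ ℳ.P (∈-filter⁺ _ x∈I (x∈I , x∈O))))
  ... | no x∉O  = ∈-++⁺ʳ (OPN.P S) (∈-++⁺ˡ (∈-filter⁺ _ x∈I x∉O))

  output∈Places-S : x ∈ 𝒩.O ++ ℳ.O → x ∈ Places S
  output∈Places-S {x} x∈O with x ∈ℕ? (𝒩.I ++ ℳ.I)
  ... | yes x∈I = ∈-++⁺ˡ (∈-++⁺ʳ 𝒩.P (∈-++⁺ʳ ℳ.P (∈-filter⁺ _ x∈I (x∈I , x∈O))))
  ... | no x∉I  = ∈-++⁺ʳ (OPN.P S) (∈-++⁺ʳ (OPN.I S) (∈-filter⁺ _ x∈O x∉I))

  Places-N⊆Places-S : x ∈ Places N → x ∈ Places S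
  Places-N⊆Places-S x∈Places with ∈-++⁻ 𝒩.P x∈Places
  ... | inj₁ x∈P = ∈-++⁺ˡ (∈-++⁺ˡ x∈P)
  ... | inj₂ x∈Interface with ∈-++⁻ 𝒩.I x∈Interface
  ...   | inj₁ x∈I = input∈Places-S (∈-++⁺ˡ x∈I)
  ...   | inj₂ x∈O = output∈Places-S (∈-++⁺ˡ x∈O)

  Places-M⊆Places-S : x ∈ Places M → x ∈ Places S
  Places-M⊆Places-S x∈Places with ∈-++⁻ ℳ.P x∈Places
  ... | inj₁ x∈P = ∈-++⁺ˡ (∈-++⁺ʳ 𝒩.P (∈-++⁺ˡ x∈P))
  ... | inj₂ x∈Interface with ∈-++⁻ ℳ.I x∈Interface
  ...   | inj₁ x∈I = input∈Places-S (∈-++⁺ʳ 𝒩.I x∈I)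
  ...   | inj₂ x∈O = output∈Places-S (∈-++⁺ʳ 𝒩.O x∈O)

  output∈Places : t ∈ OPN.T S → Arc S t y → y ∈ Places S
  output∈Places {t} {y} t∈T ty with ∈-++⁻ 𝒩.T t∈T
  ... | inj₁ t∈N =
    Places-N⊆Places-S (PN.output-place t∈N (Equivalence.from (proj₂ (arcs-agree-N t∈N y)) ty))
  ... | inj₂ t∈M =
    Places-M⊆Places-S (PM.output-place t∈M (Equivalence.from (proj₂ (arcs-agree-M t∈M y)) ty))

  initial-supported : SupportedOn (setMarking 𝒩.init ⊕ setMarking ℳ.init) (Places S)
  initial-supported x x∉Places = cong₂ _+_
    (indicator-no (x ∈ℕ? 𝒩.init) (x∉Places ∘ Places-N⊆Places-S ∘ PN.init⊆Places))
    (indicator-no (x ∈ℕ? ℳ.init) (x∉Places ∘ Places-M⊆Places-S ∘ PM.init⊆Places))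

  p≢φp : p ∈ ℳ.P → p ≢ φ p
  p≢φp {p} p∈P p≡φp =
    PM.P∉Interface p∈P (shared-only-iface p p∈N (∈-++⁺ˡ (PM.P⊆Places p∈P)))
    where
    p∈N : p ∈ Nodes N
    p∈N = ∈-++⁺ˡ (PN.P⊆Places (subst (_∈ 𝒩.P) (sym p≡φp) (P↦P p p∈P)))

  φ-input-arc : p ∈ ℳ.P → t ∈ ℳ.T → Arc M p t → Arc N (φ p) (φ t)
  φ-input-arc {p} {t} p∈P t∈T pt =
    arc-inner p t pt (PM.PI-disj p p∈P) (PM.T∉Interface t∈T ∘ ∈-++⁺ʳ ℳ.I)

  φ-output-arc : t ∈ ℳ.T → q ∈ ℳ.P → Arc M t q → Arc N (φ t) (φ q)
  φ-output-arc {t} {q} t∈T q∈P tq =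
    arc-inner t q tq (PM.T∉Interface t∈T ∘ ∈-++⁺ˡ) (PM.PO-disj q q∈P)

  φ-receive-arc : x ∈ ℳ.I → Arc M x t → x ∈ 𝒩.O × Arc N (φ t) x
  φ-receive-arc {x} {t} x∈I xt =
    subst (_∈ 𝒩.O) φx≡x (I↦O x x∈I)
    , subst (Arc N (φ t)) φx≡x (arc-iface x t xt (inj₁ x∈I))
    where
    φx≡x : φ x ≡ x
    φx≡x = iface-fixed x (∈-++⁺ˡ x∈I)

  φ-send-arc : x ∈ ℳ.O → Arc M t x → x ∈ 𝒩.I × Arc N x (φ t)
  φ-send-arc {x} {t} x∈O tx =
    subst (_∈ 𝒩.I) φx≡x (O↦I x x∈O)
    , subst (λ z → Arc N z (φ t)) φx≡x (arc-iface t x tx (inj₂ x∈O))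
    where
    φx≡x : φ x ≡ x
    φx≡x = iface-fixed x (∈-++⁺ʳ ℳ.I x∈O)

  mirrored : ℕ → Marking
  mirrored p = token p ⊕ token (φ p)

  mirror-step-receiving : p ∈ ℳ.P → t ∈ ℳ.T → q ∈ ℳ.P → x ∈ ℳ.I
    → Arc M p t → Arc M t q → Arc M x t → Reach Sn (mirrored p) (mirrored q)
  mirror-step-receiving {p} {t} {q} {x} p∈P t∈T q∈P x∈I pt tq xt =
    Reach-respˡ {n = Sn} (⊕-comm (token p) (token (φ p)))
      (Reach-respʳ {n = Sn} (⊕-comm (token (φ q)) (token q))
        (handshake {n = Sn} (∈-++⁺ˡ φt∈T) (∈-++⁺ʳ 𝒩.T t∈T)
          (Sends-transport (arcs-agree-N φt∈T)
            (PN.sending φt∈T (P↦P p p∈P) (P↦P q q∈P) (proj₁ φ-port) (φ-input-arc p∈P t∈T pt)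
                        (φ-output-arc t∈T q∈P tq) (proj₂ φ-port)))
          (Receives-transport (arcs-agree-M t∈T) (PM.receiving t∈T p∈P q∈P x∈I pt tq xt))))
    where
    φt∈T : φ t ∈ 𝒩.T
    φt∈T = T↦T t t∈T
    φ-port : x ∈ 𝒩.O × Arc N (φ t) x
    φ-port = φ-receive-arc x∈I xt

  mirror-step-sending : p ∈ ℳ.P → t ∈ ℳ.T → q ∈ ℳ.P → x ∈ ℳ.O
    → Arc M p t → Arc M t q → Arc M t x → Reach Sn (mirrored p) (mirrored q)
  mirror-step-sending {p} {t} {q} {x} p∈P t∈T q∈P x∈O pt tq tx =
    handshake {n = Sn} (∈-++⁺ʳ 𝒩.T t∈T) (∈-++⁺ˡ φt∈T)
      (Sends-transport (arcs-agree-M t∈T) (PM.sending t∈T p∈P q∈P x∈O pt tq tx))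
      (Receives-transport (arcs-agree-N φt∈T)
        (PN.receiving φt∈T (P↦P p p∈P) (P↦P q q∈P) (proj₁ φ-port) (φ-input-arc p∈P t∈T pt)
                      (φ-output-arc t∈T q∈P tq) (proj₂ φ-port)))
    where
    φt∈T : φ t ∈ 𝒩.T
    φt∈T = T↦T t t∈T
    φ-port : x ∈ 𝒩.I × Arc N x (φ t)
    φ-port = φ-send-arc x∈O tx

  mirror-step : p ∈ ℳ.P → t ∈ ℳ.T → q ∈ ℳ.P → Arc M p t → Arc M t q
    → Reach Sn (mirrored p) (mirrored q)
  mirror-step {t = t} p∈P t∈T q∈P pt tq with PM.one-interface t t∈T
  ... | x , x∈Interface , xt , _ with ∈-++⁻ ℳ.I x∈Interface
  ... | inj₁ x∈I = mirror-step-receiving p∈P t∈T q∈P x∈I pt tq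
                     ([ id , (λ tx → contradiction tx (PM.I-nopre x t x∈I)) ]′ xt)
  ... | inj₂ x∈O = mirror-step-sending p∈P t∈T q∈P x∈O pt tq
                     ([ (λ xt → contradiction xt (PM.O-nopost x t x∈O)) , id ]′ xt)

  -- Skeleton arcs alternate between places and transitions, so only the first and the last
  -- clause describe actual paths between places.
  reach-along-skeleton-path : p ∈ ℳ.P → q ∈ ℳ.P → Star (SkelArc M) p q
    → Reach Sn (mirrored p) (mirrored q)
  reach-along-skeleton-path p∈P _ ε = Reach-≗ {n = Sn} (λ _ → refl)
  reach-along-skeleton-path p∈P _ ((_ , inj₂ (p∈T , _)) ◅ _) =
    contradiction p∈T (PM.place∉T (PM.P⊆Places p∈P))
  reach-along-skeleton-path _ q∈P ((_ , inj₁ (_ , t∈T)) ◅ ε) =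
    contradiction t∈T (PM.place∉T (PM.P⊆Places q∈P))
  reach-along-skeleton-path _ _ ((_ , inj₁ (_ , t∈T)) ◅ (_ , inj₁ (t∈P , _)) ◅ _) =
    contradiction t∈T (PM.place∉T (PM.P⊆Places t∈P))
  reach-along-skeleton-path p∈P r∈P ((pt , inj₁ (_ , t∈T)) ◅ (tq , inj₂ (_ , q∈P)) ◅ path) =
    Reach-trans {n = Sn} (mirror-step p∈P t∈T q∈P pt tq) (reach-along-skeleton-path q∈P r∈P path)

  φ-fin : φ PM.fN ≡ PN.fN
  φ-fin = Equivalence.to (PN.fin≡ (φ PM.fN))
            (Equivalence.from (fin↦ (φ PM.fN)) (PM.fN , Equivalence.from (PM.fin≡ PM.fN) refl , refl))

  mirrored-fin : mirrored PM.fN ≗ setMarking 𝒩.fin ⊕ setMarking ℳ.fin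
  mirrored-fin x = begin
    token PM.fN x + token (φ PM.fN) x   ≡⟨ +-comm (token PM.fN x) _ ⟩
    token (φ PM.fN) x + token PM.fN x   ≡⟨ cong (λ f → token f x + token PM.fN x) φ-fin ⟩
    token PN.fN x + token PM.fN x       ≡⟨ sym (cong₂ _+_ (PN.setMarking-fin x) (PM.setMarking-fin x)) ⟩
    setMarking 𝒩.fin x + setMarking ℳ.fin x ∎
    where open ≡-Reasoning

  mirrored-reaches-final : p ∈ ℳ.P → Reach Sn (mirrored p) (setMarking 𝒩.fin ⊕ setMarking ℳ.fin)
  mirrored-reaches-final p∈P =
    Reach-respʳ {n = Sn} mirrored-fin
      (reach-along-skeleton-path p∈P f∈P (proj₂ (on-path _ (∈-++⁺ˡ p∈P))))
    where open IsWorkflowSkeleton PM.workflow using (f∈P; on-path)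

proposition2 : {L : Set} (N M : OPN L) (φ : ℕ → ℕ)
    → WellFormed N → WellFormed M
    → PartialMirror N M φ
    → Composable N M
    → MirrorIdentified N M φ
    → WeaklyTerminating (skeleton M) (setMarking (OPN.init M)) (setMarking (OPN.fin M))
    → (m : Marking)
    → Reach (netOf (compose N M)) (setMarking (OPN.init N) ⊕ setMarking (OPN.init M)) m
    → (p : ℕ) → p ∈ OPN.P M → m p ≡ 1 → m (φ p) ≡ 1
    → (∀ q → q ∈ Places (compose N M) → q ≢ p → q ≢ φ p → m q ≡ 0)
    → Reach (netOf (compose N M)) m (setMarking (OPN.fin N) ⊕ setMarking (OPN.fin M))
proposition2 N M φ N-wf _ mirror composable identified _
             m (_ , run , end≗m) p p∈P mp≡1 mφp≡1 elsewhere≡0 =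
  Reach-respˡ {n = Sn} m≗mirrored (mirrored-reaches-final p∈P)
  where
  open Mirrored (WellFormed.portnet N-wf) mirror composable identified
  m-supported : SupportedOn m (Places S)
  m-supported x x∉Places =
    trans (sym (end≗m x)) (Star-supportedOn output∈Places run initial-supported x x∉Places)
  m≗mirrored : m ≗ mirrored p
  m≗mirrored = ≗-token₂ (p≢φp p∈P) mp≡1 mφp≡1 m-supported elsewhere≡0
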